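{- Let $z\ge0$, let $G$ be an undirected multigraph, and let $(C,F)$ be a $z$-antler in $G$ that is $z$-properly colored by a coloring $\chi\colon V(G)\cup E(G)\to\{\dot F,\dot C,\dot R\}$. If $H$ is a connected component of $G[C\cup F]-\chi^{ -1}(\dot R)$, then every connected component $H'$ of $H-C$ is a connected component of $G[\chi_V^{ -1}(\dot F)]-\chi^{ -1}(\dot R)$ and satisfies $N_{G-\chi^{ -1}(\dot R)}(V(H'))\subseteq C\cap V(H)$.
   Context: Graphs are undirected multigraphs, possibly with self-loops and parallel edges (these count as cycles). For a set $Y$ of vertices and edges, $G-Y$ is obtained from $G[V(G)\setminus Y]$ by deleting the edges in $Y$. $N_G(X)$ is the set of vertices outside $X$ adjacent to $X$; for disjoint vertex sets $X,Y$, $e(X,Y)$ is the number of edges between them. A feedback vertex set (FVS) of $G$ is a set $X$ with $G-X$ acyclic; $\mathrm{fvs}(G)$ is its minimum size. A feedback vertex cut (FVC) is a pair of disjoint sets $C,F\subseteq V(G)$ with $G[F]$ a forest and every tree $T$ of $G[F]$ satisfying $e(V(T),V(G)\setminus(C\cup F))\le1$. An antler is an FVC $(C,F)$ with $|C|\le\mathrm{fvs}(G[C\cup F])$. For $C\subseteq V(G)$, a $C$-certificate is a subgraph $H$ of $G$ such that $C$ is a minimum FVS of $H$; it has order $z$ if every connected component $H'$ of $H$ satisfies $\mathrm{fvs}(H')=|C\cap V(H')|\le z$. A $z$-antler is an antler $(C,F)$ such that $G[C\cup F]$ contains a $C$-certificate of order $z$. For a coloring $\chi\colon V(G)\cup E(G)\to\{\dot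 F,\dot C,\dot R\}$ and a color $c$, $\chi_V^{ -1}(c)=\chi^{ -1}(c)\cap V(G)$. A $z$-antler $(C,F)$ is $z$-properly colored by $\chi$ if (i) $F\subseteq\chi_V^{ -1}(\dot F)$, (ii) $C\subseteq\chi_V^{ -1}(\dot C)$, (iii) $N_G(F)\setminus C\subseteq\chi_V^{ -1}(\dot R)$, and (iv) $G[C\cup F]-\chi^{ -1}(\dot R)$ is a $C$-certificate of order $z$. -}

module Defs where

open import Data.Nat using (ℕ; zero; suc; _≤_)
open import Data.Nat.DivMod using (_mod_)
open import Data.Fin using (Fin; toℕ)
open import Data.Fin.Subset using (Subset; _∈_; _∉_; _⊆_; _∪_; _∩_; _─_; ∣_∣; ∁)
  renaming (⊤ to allS; ⊥ to noneS)
open import Data.Fin.Subset.Properties using (_∈?_)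
open import Data.Bool using (Bool; true; false; _∧_; _∨_; not)
open import Data.Vec using (tabulate)
open import Data.Product using (Σ; Σ-syntax; _×_; _,_; proj₁; proj₂)
open import Data.Sum using (_⊎_)
open import Relation.Nullary using (¬_; does)
open import Relation.Binary.PropositionalEquality using (_≡_)
open import Function.Definitions using (Injective)

-- Multigraphs: vertices Fin n, edges Fin m, each edge has two endpoints
-- (self-loops and parallel edges allowed).

Graph : ℕ → ℕ → Set
Graph n m = Fin m → Fin n × Fin n

record Sub (n m : ℕ) : Set where
  constructor ⟨_,_⟩
  field
    vs : Subset n
    es : Subset m
open Sub public

module _ {n m : ℕ} (G : Graph n m) where

  Connects : Fin m → Fin n → Fin n → Set
  Connects e u w = G e ≡ (u , w) ⊎ G e ≡ (w , u)

  inS : ∀ {k} → Fin k → Subset k → Bool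
  inS u S = does (u ∈? S)

  whole : Sub n m
  whole = ⟨ allS , allS ⟩

  induced : Subset n → Sub n m
  induced S = ⟨ S , tabulate (λ e → inS (proj₁ (G e)) S ∧ inS (proj₂ (G e)) S) ⟩

  remove : Sub n m → Subset n → Subset m → Sub n m
  remove H YV YE =
    ⟨ vs H ─ YV
    , tabulate (λ e → inS e (es H) ∧ not (inS e YE)
                      ∧ not (inS (proj₁ (G e)) YV) ∧ not (inS (proj₂ (G e)) YV)) ⟩

  IsSubgraphOf : Sub n m → Sub n m → Set
  IsSubgraphOf H K =
    vs H ⊆ vs K × es H ⊆ es K
    × (∀ e → e ∈ es H → proj₁ (G e) ∈ vs H × proj₂ (G e) ∈ vs H)

  next : ∀ {k} → Fin (suc k) → Fin (suc k)
  next {k} i = suc (toℕ i) mod (suc k)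

  -- A cycle in H: distinct vertices v 0 .. v k and distinct edges e 0 .. e k
  -- with e i joining v i and v (i+1 mod (k+1)).  (k = 0: self-loop,
  -- k = 1: pair of parallel edges.)
  record Cycle (H : Sub n m) : Set where
    field
      k     : ℕ
      v     : Fin (suc k) → Fin n
      e     : Fin (suc k) → Fin m
      v-inj : Injective _≡_ _≡_ v
      e-inj : Injective _≡_ _≡_ e
      v∈    : ∀ i → v i ∈ vs H
      e∈    : ∀ i → e i ∈ es H
      conn  : ∀ i → Connects (e i) (v i) (v (next i))

  Acyclic : Sub n m → Set
  Acyclic H = ¬ Cycle H

  IsFVS : Sub n m → Subset n → Set
  IsFVS H X = X ⊆ vs H × Acyclic (remove H X noneS)

  IsMinFVS : Sub n m → Subset n → Set
  IsMinFVS H X = IsFVS H X × (∀ Y → IsFVS H Y → ∣ X ∣ ≤ ∣ Y ∣)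

  FvsIs : Sub n m → ℕ → Set
  FvsIs H k = (Σ[ X ∈ Subset n ] (IsFVS H X × ∣ X ∣ ≡ k))
              × (∀ Y → IsFVS H Y → k ≤ ∣ Y ∣)

  data Reach (H : Sub n m) (v : Fin n) : Fin n → Set where
    here : Reach H v v
    step : ∀ {u w e} → Reach H v u → e ∈ es H → Connects e u w → Reach H v w

  IsComponent : Sub n m → Sub n m → Set
  IsComponent H H' =
    Σ[ v ∈ Fin n ] (v ∈ vs H
      × (∀ u → (u ∈ vs H' → Reach H v u) × (Reach H v u → u ∈ vs H'))
      × (∀ e → (e ∈ es H' → e ∈ es H × proj₁ (G e) ∈ vs H' × proj₂ (G e) ∈ vs H')
             × (e ∈ es H × proj₁ (G e) ∈ vs H' × proj₂ (G e) ∈ vs H' → e ∈ es H')))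

  eCount : Subset n → Subset n → ℕ
  eCount X Y = ∣ tabulate (λ e → (inS (proj₁ (G e)) X ∧ inS (proj₂ (G e)) Y)
                                 ∨ (inS (proj₂ (G e)) X ∧ inS (proj₁ (G e)) Y)) ∣

  InN : Sub n m → Subset n → Fin n → Set
  InN H X u = u ∉ X × Σ[ e ∈ Fin m ] (e ∈ es H × Σ[ x ∈ Fin n ] (x ∈ X × Connects e u x))

  IsFVC : Subset n → Subset n → Set
  IsFVC C F =
    (∀ v → v ∈ C → v ∉ F)
    × Acyclic (induced F)
    × (∀ T → IsComponent (induced F) T → eCount (vs T) (∁ (C ∪ F)) ≤ 1)

  IsAntler : Subset n → Subset n → Set
  IsAntler C F = IsFVC C F × (∀ X → IsFVS (induced (C ∪ F)) X → ∣ C ∣ ≤ ∣ X ∣)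

  IsCertificate : ℕ → Subset n → Sub n m → Set
  IsCertificate z C H =
    IsMinFVS H C
    × (∀ H' → IsComponent H H' → FvsIs H' ∣ C ∩ vs H' ∣ × ∣ C ∩ vs H' ∣ ≤ z)

  IsZAntler : ℕ → Subset n → Subset n → Set
  IsZAntler z C F =
    IsAntler C F
    × Σ[ H ∈ Sub n m ] (IsSubgraphOf H (induced (C ∪ F)) × IsCertificate z C H)

data Col : Set where
  Ḟ Ċ Ṙ : Col

_==ᶜ_ : Col → Col → Bool
Ḟ ==ᶜ Ḟ = true
Ċ ==ᶜ Ċ = true
Ṙ ==ᶜ Ṙ = true
_ ==ᶜ _ = false

record Coloring (n m : ℕ) : Set where
  constructor coloring
  field
    onV : Fin n → Col
    onE : Fin m → Col
open Coloring public

preV : ∀ {n m} → Coloring n m → Col → Subset n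
preV χ c = tabulate (λ v → onV χ v ==ᶜ c)

preE : ∀ {n m} → Coloring n m → Col → Subset m
preE χ c = tabulate (λ e → onE χ e ==ᶜ c)

module _ {n m : ℕ} (G : Graph n m) where

  removeR : Coloring n m → Sub n m → Sub n m
  removeR χ H = remove G H (preV χ Ṙ) (preE χ Ṙ)

  IsZProperlyColored : ℕ → Subset n → Subset n → Coloring n m → Set
  IsZProperlyColored z C F χ =
    F ⊆ preV χ Ḟ
    × C ⊆ preV χ Ċ
    × (∀ v → InN G (whole G) F v → v ∉ C → v ∈ preV χ Ṙ)
    × IsCertificate G z C (removeR χ (induced G (C ∪ F)))

{-# OPTIONS --safe #-}
module Submission where

-- Vertices of H' lie in F and are not red. By (iii), every non-red vertex
-- adjacent to F lies in C ∪ F, so a non-red edge leaving H' towards a non-red vertex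
-- is an edge of G[C ∪ F] − χ⁻¹(Ṙ), hence of its component H; if the other end
-- is not in C, the edge even lies in H − C and so the other end lies in H'.
-- Thus H' is closed in G[χ_V⁻¹(Ḟ)] − χ⁻¹(Ṙ), and its only neighbours in
-- G − χ⁻¹(Ṙ) are vertices of C reached inside H.

open import Defs
open import Data.Bool using (Bool; true; false; _∧_; not)
open import Data.Empty using (⊥-elim)
open import Data.Fin using (Fin)
open import Data.Fin.Subset using (Subset; _∈_; _∉_; _⊆_; _∪_; _∩_; _─_; ⊥; inside; outside)
open import Data.Fin.Subset.Properties
  using (_∈?_; x∈p∪q⁻; x∈p∪q⁺; x∈p∩q⁺; x∈p∧x∉q⇒x∈p─q; p─q⊆p; ∉⊥; ∈⊤)
open import Data.Nat using (ℕ)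
open import Data.Product using (_×_; _,_; proj₁; proj₂)
open import Data.Sum using (inj₁; inj₂)
open import Data.Vec using (tabulate; _∷_; here; there)
open import Data.Vec.Properties using (lookup∘tabulate; []=⇒lookup; lookup⇒[]=)
open import Relation.Nullary using (¬_; Dec; yes; no; does)
open import Relation.Nullary.Decidable using (dec-true; dec-false)
open import Relation.Binary.PropositionalEquality using (_≡_; refl; sym; trans; cong; subst)

∧-true⁻ : ∀ {a b} → a ∧ b ≡ true → a ≡ true × b ≡ true
∧-true⁻ {true}  {true}  _ = refl , refl
∧-true⁻ {true}  {false} ()
∧-true⁻ {false}         ()

∧-true⁺ : ∀ {a b} → a ≡ true → b ≡ true → a ∧ b ≡ true
∧-true⁺ refl refl = refl

does≡true⇒ : ∀ {a} {A : Set a} (d : Dec A) → does d ≡ true → A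
does≡true⇒ (yes a) _ = a
does≡true⇒ (no _)  ()

not-does≡true⇒¬ : ∀ {a} {A : Set a} (d : Dec A) → not (does d) ≡ true → ¬ A
not-does≡true⇒¬ (yes _)  ()
not-does≡true⇒¬ (no ¬a)  _ = ¬a

¬⇒not-does≡true : ∀ {a} {A : Set a} (d : Dec A) → ¬ A → not (does d) ≡ true
¬⇒not-does≡true d ¬a = cong not (dec-false d ¬a)

∈-tabulate⁻ : ∀ {k} {f : Fin k → Bool} {i} → i ∈ tabulate f → f i ≡ true
∈-tabulate⁻ {f = f} {i} i∈ = trans (sym (lookup∘tabulate f i)) ([]=⇒lookup i∈)

∈-tabulate⁺ : ∀ {k} {f : Fin k → Bool} i → f i ≡ true → i ∈ tabulate f
∈-tabulate⁺ {f = f} i fi = lookup⇒[]= i (tabulate f) (trans (lookup∘tabulate f i) fi)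

x∈p─q⇒x∉q : ∀ {k} {x : Fin k} (p q : Subset k) → x ∈ p ─ q → x ∉ q
x∈p─q⇒x∉q (inside ∷ p) (outside ∷ q) here       ()
x∈p─q⇒x∉q (_      ∷ p) (_       ∷ q) (there x∈) (there x∈q) = x∈p─q⇒x∉q p q x∈ x∈q

x∈p─q⁻ : ∀ {k} {x : Fin k} (p q : Subset k) → x ∈ p ─ q → x ∈ p × x ∉ q
x∈p─q⁻ p q x∈ = p─q⊆p p q x∈ , x∈p─q⇒x∉q p q x∈

x∈p∪q∧x∉p⇒x∈q : ∀ {k} {x : Fin k} (p q : Subset k) → x ∈ p ∪ q → x ∉ p → x ∈ q
x∈p∪q∧x∉p⇒x∈q p q x∈ x∉p with x∈p∪q⁻ p q x∈
... | inj₁ x∈p = ⊥-elim (x∉p x∈p)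
... | inj₂ x∈q = x∈q

==ᶜ⇒≡ : ∀ a b → (a ==ᶜ b) ≡ true → a ≡ b
==ᶜ⇒≡ Ḟ Ḟ _ = refl
==ᶜ⇒≡ Ċ Ċ _ = refl
==ᶜ⇒≡ Ṙ Ṙ _ = refl
==ᶜ⇒≡ Ḟ Ċ ()
==ᶜ⇒≡ Ḟ Ṙ ()
==ᶜ⇒≡ Ċ Ḟ ()
==ᶜ⇒≡ Ċ Ṙ ()
==ᶜ⇒≡ Ṙ Ḟ ()
==ᶜ⇒≡ Ṙ Ċ ()

∈preV-unique : ∀ {n m} {χ : Coloring n m} {c d u} → u ∈ preV χ c → u ∈ preV χ d → c ≡ d
∈preV-unique {χ = χ} {c} {d} {u} u∈c u∈d =
  trans (sym (==ᶜ⇒≡ (onV χ u) c (∈-tabulate⁻ u∈c))) (==ᶜ⇒≡ (onV χ u) d (∈-tabulate⁻ u∈d))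

module _ {n m : ℕ} (G : Graph n m) where

  BothEnds : (Fin n → Set) → Fin m → Set
  BothEnds P e = P (proj₁ (G e)) × P (proj₂ (G e))

  EdgeClosed : Sub n m → Set
  EdgeClosed K = ∀ {e} → e ∈ es K → BothEnds (_∈ vs K) e

  Connects-sym : ∀ {e a b} → Connects G e a b → Connects G e b a
  Connects-sym (inj₁ eq) = inj₂ eq
  Connects-sym (inj₂ eq) = inj₁ eq

  Connects⇒BothEnds : ∀ {e a b} (P : Fin n → Set) → Connects G e a b → P a → P b → BothEnds P e
  Connects⇒BothEnds P (inj₁ eq) pa pb rewrite eq = pa , pb
  Connects⇒BothEnds P (inj₂ eq) pa pb rewrite eq = pb , pa

  BothEnds⇒target : ∀ {e a b} (P : Fin n → Set) → Connects G e a b → BothEnds P e → P b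
  BothEnds⇒target P (inj₁ eq) (_ , p₂) = subst P (cong proj₂ eq) p₂
  BothEnds⇒target P (inj₂ eq) (p₁ , _) = subst P (cong proj₁ eq) p₁

  ∈-induced-es⁻ : ∀ {S e} → e ∈ es (induced G S) → BothEnds (_∈ S) e
  ∈-induced-es⁻ {S} e∈ =
    let (s₁ , s₂) = ∧-true⁻ (∈-tabulate⁻ e∈)
    in does≡true⇒ (_ ∈? S) s₁ , does≡true⇒ (_ ∈? S) s₂

  ∈-induced-es⁺ : ∀ {S e} → BothEnds (_∈ S) e → e ∈ es (induced G S)
  ∈-induced-es⁺ {S} {e} (s₁ , s₂) =
    ∈-tabulate⁺ e (∧-true⁺ (dec-true (_ ∈? S) s₁) (dec-true (_ ∈? S) s₂))

  ∈-remove-es⁻ : ∀ {H YV YE e} → e ∈ es (remove G H YV YE)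
               → e ∈ es H × e ∉ YE × BothEnds (_∉ YV) e
  ∈-remove-es⁻ {H} {YV} {YE} {e} e∈ =
    let (e∈H , rest)   = ∧-true⁻ (∈-tabulate⁻ e∈)
        (e∉YE , ends)  = ∧-true⁻ rest
        (s₁ , s₂)      = ∧-true⁻ ends
    in does≡true⇒ (e ∈? es H) e∈H , not-does≡true⇒¬ (e ∈? YE) e∉YE
     , not-does≡true⇒¬ (_ ∈? YV) s₁ , not-does≡true⇒¬ (_ ∈? YV) s₂

  ∈-remove-es⁺ : ∀ {H YV YE e} → e ∈ es H → e ∉ YE → BothEnds (_∉ YV) e
               → e ∈ es (remove G H YV YE)
  ∈-remove-es⁺ {H} {YV} {YE} {e} e∈H e∉YE (s₁ , s₂) =
    ∈-tabulate⁺ e (∧-true⁺ (dec-true (e ∈? es H) e∈H)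
                  (∧-true⁺ (¬⇒not-does≡true (e ∈? YE) e∉YE)
                  (∧-true⁺ (¬⇒not-does≡true (_ ∈? YV) s₁) (¬⇒not-does≡true (_ ∈? YV) s₂))))

  induced-closed : ∀ S → EdgeClosed (induced G S)
  induced-closed S = ∈-induced-es⁻

  remove-closed : ∀ {H YV YE} → EdgeClosed H → EdgeClosed (remove G H YV YE)
  remove-closed {H} closed e∈ =
    let (e∈H , _ , ∉₁ , ∉₂) = ∈-remove-es⁻ {H} e∈
        (∈₁ , ∈₂)          = closed e∈H
    in x∈p∧x∉q⇒x∈p─q ∈₁ ∉₁ , x∈p∧x∉q⇒x∈p─q ∈₂ ∉₂

  Reach-closed : ∀ {K v u} → EdgeClosed K → v ∈ vs K → Reach G K v u → u ∈ vs K
  Reach-closed     closed v∈ here          = v∈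
  Reach-closed {K} closed v∈ (step _ e∈ c) = BothEnds⇒target (_∈ vs K) c (closed e∈)

  Reach-mono : ∀ {K K' v u} → es K ⊆ es K' → Reach G K v u → Reach G K' v u
  Reach-mono K⊆K' here          = here
  Reach-mono K⊆K' (step r e∈ c) = step (Reach-mono K⊆K' r) (K⊆K' e∈) c

  component-⊆ : ∀ {K H'} → EdgeClosed K → IsComponent G K H' → vs H' ⊆ vs K
  component-⊆ closed (_ , r∈ , vert , _) u∈ = Reach-closed closed r∈ (proj₁ (vert _) u∈)

  component-es⊆ : ∀ {K H'} → IsComponent G K H' → es H' ⊆ es K
  component-es⊆ (_ , _ , _ , edge) e∈ = proj₁ (proj₁ (edge _) e∈)

  component-closed : ∀ {K H'} → IsComponent G K H' → EdgeClosed H'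
  component-closed (_ , _ , _ , edge) e∈ = proj₂ (proj₁ (edge _) e∈)

  component-target : ∀ {K H' e a b} → IsComponent G K H'
                   → a ∈ vs H' → e ∈ es K → Connects G e a b → b ∈ vs H'
  component-target (_ , _ , vert , _) a∈ e∈ c = proj₂ (vert _) (step (proj₁ (vert _) a∈) e∈ c)

  component-edge : ∀ {K H' e a b} → IsComponent G K H'
                 → a ∈ vs H' → e ∈ es K → Connects G e a b → e ∈ es H'
  component-edge {H' = H'} comp a∈ e∈ c =
    proj₂ (proj₂ (proj₂ (proj₂ comp)) _)
      (e∈ , Connects⇒BothEnds (_∈ vs H') c a∈ (component-target comp a∈ e∈ c))

  component-of-supergraph : ∀ {K L H'} → IsComponent G K H'
    → vs H' ⊆ vs L → es K ⊆ es L
    → (∀ {a e b} → a ∈ vs H' → e ∈ es L → Connects G e a b → e ∈ es K)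
    → IsComponent G L H'
  component-of-supergraph {L = L} {H'} comp@(r , _ , vert , edge) H'⊆L K⊆L L-edge∈K =
    r , H'⊆L r∈H'
      , (λ u → (λ u∈ → Reach-mono K⊆L (proj₁ (vert u) u∈)) , reach⇒∈)
      , λ e → (λ e∈ → K⊆L (component-es⊆ comp e∈) , component-closed comp e∈)
            , λ (e∈L , ends) → proj₂ (edge e) (L-edge∈K (proj₁ ends) e∈L (inj₁ refl) , ends)
    where
    r∈H' : r ∈ vs H'
    r∈H' = proj₂ (vert r) here

    reach⇒∈ : ∀ {u} → Reach G L r u → u ∈ vs H'
    reach⇒∈ here          = r∈H'
    reach⇒∈ (step r e∈ c) = component-target comp (reach⇒∈ r) (L-edge∈K (reach⇒∈ r) e∈ c) c

module _ {n m : ℕ} (G : Graph n m) (C F : Subset n) (χ : Coloring n m)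
         (F⊆Ḟ : F ⊆ preV χ Ḟ) (C⊆Ċ : C ⊆ preV χ Ċ)
         (N[F]─C⊆Ṙ : ∀ v → InN G (whole G) F v → v ∉ C → v ∈ preV χ Ṙ)
         {H H' : Sub n m}
         (H-comp : IsComponent G (removeR G χ (induced G (C ∪ F))) H)
         (H'-comp : IsComponent G (remove G H C ⊥) H')
         where

  private
    R : Subset n
    R = preV χ Ṙ

    RE : Subset m
    RE = preE χ Ṙ

    H─C : Sub n m
    H─C = remove G H C ⊥

    L : Sub n m
    L = removeR G χ (induced G (preV χ Ḟ))

  H'-vertex : ∀ {u} → u ∈ vs H' → u ∈ F × u ∉ R × u ∈ vs H × u ∉ C
  H'-vertex u∈H' =
    let (u∈H , u∉C)   = x∈p─q⁻ (vs H) C (component-⊆ G (remove-closed G (component-closed G H-comp)) H'-comp u∈H')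
        (u∈C∪F , u∉R) = x∈p─q⁻ (C ∪ F) R (component-⊆ G (remove-closed G (induced-closed G (C ∪ F))) H-comp u∈H)
    in x∈p∪q∧x∉p⇒x∈q C F u∈C∪F u∉C , u∉R , u∈H , u∉C

  neighbour-of-H' : ∀ {e a b} → a ∈ vs H' → Connects G e a b → b ∉ R → b ∈ C ∪ F
  neighbour-of-H' {e} {a} {b} a∈ c b∉R with b ∈? C | b ∈? F
  ... | yes b∈C | _        = x∈p∪q⁺ (inj₁ b∈C)
  ... | no _    | yes b∈F  = x∈p∪q⁺ (inj₂ b∈F)
  ... | no b∉C  | no b∉F   =
    ⊥-elim (b∉R (N[F]─C⊆Ṙ b (b∉F , e , ∈⊤ , a , proj₁ (H'-vertex a∈) , Connects-sym G c) b∉C))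

  edge-from-H' : ∀ {e a b} → a ∈ vs H' → e ∉ RE → Connects G e a b → b ∉ R → e ∈ es H
  edge-from-H' a∈ e∉RE c b∉R =
    let (a∈F , a∉R , a∈H , _) = H'-vertex a∈
        ends∈C∪F = Connects⇒BothEnds G (_∈ (C ∪ F)) c (x∈p∪q⁺ (inj₂ a∈F)) (neighbour-of-H' a∈ c b∉R)
        ends∉R   = Connects⇒BothEnds G (_∉ R) c a∉R b∉R
    in component-edge G H-comp a∈H (∈-remove-es⁺ G {induced G (C ∪ F)} {R} {RE} (∈-induced-es⁺ G ends∈C∪F) e∉RE ends∉R) c

  edge-from-H'-avoiding-C : ∀ {e a b} → a ∈ vs H' → e ∉ RE → Connects G e a b → b ∉ R → b ∉ C
                          → e ∈ es H─C
  edge-from-H'-avoiding-C a∈ e∉RE c b∉R b∉C =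
    ∈-remove-es⁺ G {H} {C} {⊥} (edge-from-H' a∈ e∉RE c b∉R) ∉⊥
      (Connects⇒BothEnds G (_∉ C) c (proj₂ (proj₂ (proj₂ (H'-vertex a∈)))) b∉C)

  H─C⊆L : es H─C ⊆ es L
  H─C⊆L e∈ =
    let (e∈H , _ , ends∉C)           = ∈-remove-es⁻ G {H} e∈
        (e∈G[C∪F] , e∉RE , ends∉R)   = ∈-remove-es⁻ G {induced G (C ∪ F)} (component-es⊆ G H-comp e∈H)
        (∈₁ , ∈₂)                    = ∈-induced-es⁻ G e∈G[C∪F]
    in ∈-remove-es⁺ G {induced G (preV χ Ḟ)} {R} {RE} (∈-induced-es⁺ G (inḞ ∈₁ (proj₁ ends∉C) , inḞ ∈₂ (proj₂ ends∉C))) e∉RE ends∉R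
    where
    inḞ : ∀ {u} → u ∈ C ∪ F → u ∉ C → u ∈ preV χ Ḟ
    inḞ u∈ u∉C = F⊆Ḟ (x∈p∪q∧x∉p⇒x∈q C F u∈ u∉C)

  L-edge-from-H' : ∀ {a e b} → a ∈ vs H' → e ∈ es L → Connects G e a b → e ∈ es H─C
  L-edge-from-H' a∈ e∈L c =
    let (e∈G[Ḟ] , e∉RE , ends∉R) = ∈-remove-es⁻ G {induced G (preV χ Ḟ)} e∈L
        b∈Ḟ = BothEnds⇒target G _ c (∈-induced-es⁻ G e∈G[Ḟ])
    in edge-from-H'-avoiding-C a∈ e∉RE c (BothEnds⇒target G _ c ends∉R)
         (λ b∈C → Ḟ≢Ċ (∈preV-unique {χ = χ} b∈Ḟ (C⊆Ċ b∈C)))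
    where
    Ḟ≢Ċ : ¬ (Ḟ ≡ Ċ)
    Ḟ≢Ċ ()

  H'-component-of-G[Ḟ]─Ṙ : IsComponent G L H'
  H'-component-of-G[Ḟ]─Ṙ = component-of-supergraph G H'-comp H'⊆L H─C⊆L L-edge-from-H'
    where
    H'⊆L : vs H' ⊆ vs L
    H'⊆L u∈ = let (u∈F , u∉R , _) = H'-vertex u∈ in x∈p∧x∉q⇒x∈p─q (F⊆Ḟ u∈F) u∉R

  N[H']⊆C∩H : ∀ u → InN G (removeR G χ (whole G)) (vs H') u → u ∈ C ∩ vs H
  N[H']⊆C∩H u (u∉H' , e , e∈ , x , x∈H' , c) = neighbour (u ∈? C)
    where
    x→u : Connects G e x u
    x→u = Connects-sym G c

    e∉RE : e ∉ RE
    e∉RE = proj₁ (proj₂ (∈-remove-es⁻ G {whole G} e∈))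

    u∉R : u ∉ R
    u∉R = BothEnds⇒target G (_∉ R) x→u (proj₂ (proj₂ (∈-remove-es⁻ G {whole G} e∈)))

    neighbour : Dec (u ∈ C) → u ∈ C ∩ vs H
    neighbour (yes u∈C) =
      x∈p∩q⁺ (u∈C , BothEnds⇒target G (_∈ vs H) x→u
                      (component-closed G H-comp (edge-from-H' x∈H' e∉RE x→u u∉R)))
    neighbour (no u∉C) =
      ⊥-elim (u∉H' (component-target G H'-comp x∈H' (edge-from-H'-avoiding-C x∈H' e∉RE x→u u∉R u∉C) x→u))

lemma24 : ∀ {n m} (z : ℕ) (G : Graph n m) (C F : Subset n) (χ : Coloring n m)
    → IsZAntler G z C F
    → IsZProperlyColored G z C F χ
    → ∀ H → IsComponent G (removeR G χ (induced G (C ∪ F))) H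
    → ∀ H' → IsComponent G (remove G H C ⊥) H'
    → IsComponent G (removeR G χ (induced G (preV χ Ḟ))) H'
      × (∀ u → InN G (removeR G χ (whole G)) (vs H') u → u ∈ C ∩ vs H)
lemma24 z G C F χ _ (F⊆Ḟ , C⊆Ċ , N[F]─C⊆Ṙ , _) H H-comp H' H'-comp =
    H'-component-of-G[Ḟ]─Ṙ G C F χ F⊆Ḟ C⊆Ċ N[F]─C⊆Ṙ H-comp H'-comp
  , N[H']⊆C∩H G C F χ F⊆Ḟ C⊆Ċ N[F]─C⊆Ṙ H-comp H'-comp
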